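{- Suppose $G_n$ is a finite Weyl group. For $1\le i<j\le n-1$, $$(\sigma_{j-1}\sigma_{j-2}\cdots\sigma_i)^{(j-i+1)h_{ij}}\in B_{G_n}\quad\text{and}\quad(\sigma_{n-1}\cdots\sigma_1)^{nh}\in B_{G_n}.$$ In particular, if $(s_is_{i+1})^{m}=1$ with $m=m_{i,i+1}\in\{2,3,4,6\}$, then $\sigma_i^{m}\in B_{G_n}$.
   Context: $G_n$ is the Weyl group, generated by simple reflections $s_1,\dots,s_n$, of a finite-type Cartan matrix with Dynkin diagram $\Delta$; $c=s_1s_2\cdots s_n$ is the Coxeter element and $h$ its Coxeter number. For $i\le j$, $\Delta(i--j)$ is the subdiagram on vertices $\{i,i+1,\dots,j\}$ and $h_{ij}$ is its Coxeter number (order of $c_{ij}=s_is_{i+1}\cdots s_j$). The integer $m_{i,i+1}$ is $2,3,4,6$ according as $a_{i,i+1}a_{i+1,i}=0,1,2,3$. The braid group $B_n=\langle\sigma_1,\dots,\sigma_{n-1}\rangle$ (braid relations) acts on $G_n^n$ by $\sigma_k.(\dots,g_k,g_{k+1},\dots)=(\dots,g_kg_{k+1}g_k^{ -1},g_k,\dots)$ and $\sigma_k^{ -1}.(\dots,g_k,g_{k+1},\dots)=(\dots,g_{k+1},g_{k+1}^{ -1}g_kg_{k+1},\dots)$, other entries fixed. $B_{G_n}$ is the stabilizer in $B_n$ of $(s_1,\dots,s_n)$. -}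

module Defs where

open import Data.Nat using (ℕ; zero; suc; _≡ᵇ_; _∸_; _<?_) renaming (_+_ to _+ℕ_)
open import Data.Integer using (ℤ; +_; _+_; _-_; _*_; _≤_; -[1+_])
open import Data.Fin using (Fin; toℕ; fromℕ<) renaming (zero to fzero; suc to fsuc)
open import Data.List using (List; []; _∷_; _++_; reverse; foldr; concat; replicate; applyUpTo; map; [_])
open import Data.List.Relation.Binary.Pointwise using (Pointwise)
open import Data.List.Membership.Propositional using (_∈_)
open import Data.List.Relation.Unary.Any using (Any)
open import Data.Product using (Σ; _×_; ∃)
open import Data.Bool using (if_then_else_)
open import Relation.Binary.PropositionalEquality using (_≡_)
open import Relation.Nullary using (¬_; yes; no)

-- Cartan matrices (indices 0-based as Fin n; paper's index i is toℕ p + 1)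

Mat : ℕ → Set
Mat n = Fin n → Fin n → ℤ

record IsGCM {n : ℕ} (A : Mat n) : Set where
  field
    diag     : ∀ p → A p p ≡ + 2
    offdiag  : ∀ p q → ¬ (p ≡ q) → A p q ≤ + 0
    zero-sym : ∀ p q → A p q ≡ + 0 → A q p ≡ + 0

-- entry a_{ij} with 1-based natural-number indices (0 if out of range)
ent : ∀ {n} → Mat n → ℕ → ℕ → ℤ
ent {n} A zero j = + 0
ent {n} A (suc i) zero = + 0
ent {n} A (suc i) (suc j) with i <? n | j <? n
... | yes p | yes q = A (fromℕ< p) (fromℕ< q)
... | _ | _ = + 0

sumFin : ∀ {n} → (Fin n → ℤ) → ℤ
sumFin {zero} f = + 0
sumFin {suc n} f = f fzero + sumFin (λ q → f (fsuc q))

-- The Weyl group G_n, acting on the root lattice ℤ^n (coordinates w.r.t.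
-- simple roots).  s_i (α_j) = α_j - a_ij α_i.

Vect : ℕ → Set
Vect n = Fin n → ℤ

-- simple reflection s_i, i a 1-based index (identity if out of range)
refl-s : ∀ {n} → Mat n → ℕ → Vect n → Vect n
refl-s A i v p =
  if (suc (toℕ p) ≡ᵇ i) then v p - sumFin (λ q → A p q * v q) else v p

-- elements of G_n are represented by words in the generators s_i
-- (1-based indices); the word i₁ i₂ … i_k denotes s_{i₁} s_{i₂} ⋯ s_{i_k}.
Word : Set
Word = List ℕ

eval : ∀ {n} → Mat n → Word → Vect n → Vect n
eval A w v = foldr (refl-s A) v w

_≈[_]_ : ∀ {n} → Word → Mat n → Word → Set
w ≈[ A ] w' = ∀ v p → eval A w v p ≡ eval A w' v p

-- group operations on representatives (s_i² = 1, so inverse = reversal)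
inv : Word → Word
inv = reverse

pow : Word → ℕ → Word
pow w k = concat (replicate k w)

FiniteWeyl : ∀ {n} → Mat n → Set
FiniteWeyl A = Σ (List Word) λ L → ∀ (w : Word) → Any (λ u → w ≈[ A ] u) L

IsOrder : ∀ {n} → Mat n → Word → ℕ → Set
IsOrder A w h =
  (0 Data.Nat.< h) × (pow w h ≈[ A ] []) ×
  (∀ k → 0 Data.Nat.< k → k Data.Nat.< h → ¬ (pow w k ≈[ A ] []))

range : ℕ → ℕ → List ℕ
range i j = applyUpTo (λ k → i +ℕ k) (suc j ∸ i)

-- s_i s_{i+1} ⋯ s_j   (c = coxElt 1 n is the Coxeter element)
coxElt : ℕ → ℕ → Word
coxElt = range

-- Braid group action on G_n^n (tuples as lists of length n)

Tuple : Set
Tuple = List Word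

σact : ℕ → Tuple → Tuple
σact zero t = t
σact (suc zero) (a ∷ b ∷ r) = (a ++ b ++ inv a) ∷ a ∷ r
σact (suc zero) t = t
σact (suc (suc k)) [] = []
σact (suc (suc k)) (x ∷ r) = x ∷ σact (suc k) r

-- a positive braid word σ_{a₁} σ_{a₂} ⋯ σ_{a_m}, acting on the left
BraidWord : Set
BraidWord = List ℕ

bact : BraidWord → Tuple → Tuple
bact β t = foldr σact t β

bpow : BraidWord → ℕ → BraidWord
bpow β k = concat (replicate k β)

descB : ℕ → ℕ → BraidWord
descB i j = reverse (range i (j ∸ 1))

stdTuple : ℕ → Tuple
stdTuple n = map [_] (range 1 n)

InStab : ∀ {n} → Mat n → BraidWord → Set
InStab {n} A β = Pointwise (λ w w' → w ≈[ A ] w') (bact β (stdTuple n)) (stdTuple n)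

-- m_{i,i+1} as a function of a_{i,i+1} a_{i+1,i}
data MVal : ℤ → ℕ → Set where
  m0 : MVal (+ 0) 2
  m1 : MVal (+ 1) 3
  m2 : MVal (+ 2) 4
  m3 : MVal (+ 3) 6

-- For a tuple (g₁, …, g_L) in a group the braid σ_{L-1}⋯σ₁ acts by
-- (g₁, …, g_L) ↦ (g₁g₂g₁⁻¹, …, g₁g_Lg₁⁻¹, g₁).  Applying it L times conjugates every entry by
-- the product P = g₁⋯g_L (each step conjugates the remaining entries by the next factor), so its
-- (L h)-th power fixes the tuple as soon as P^h = 1.  On the block (s_i, …, s_j) of (s₁, …, s_n)
-- the product is c_ij, which gives the first two claims.  For the pair (s_i, s_{i+1}), σ_i^{2k}
-- conjugates by Q = (s_i s_{i+1})^k; since s_i and s_{i+1} are involutions, s_i Q⁻¹ = Q s_i and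
-- s_{i+1} Q = Q⁻¹ s_{i+1}, and these show that σ_i^m fixes the pair whenever (s_i s_{i+1})^m = 1,
-- for m even or odd.
module Submission where

open import Defs
open import Algebra.Bundles using (Group)
open import Data.Bool using (true; false; if_then_else_; T)
open import Data.Empty using (⊥-elim)
open import Data.Fin using (Fin; toℕ) renaming (zero to fzero; suc to fsuc)
import Data.Fin.Properties as Fin
open import Data.Integer as ℤ using (ℤ) renaming (_+_ to _+ℤ_; _-_ to _-ℤ_; _*_ to _*ℤ_)
open import Data.Integer.Tactic.RingSolver using (solve-∀)
open import Data.List using (List; []; _∷_; _++_; [_]; map; foldr; replicate; length; reverse; applyUpTo)
import Data.List.Properties as List
import Data.List.Relation.Binary.Pointwise as Pointwise
open import Data.Nat using (ℕ; zero; suc; _≤_; _<_; _∸_; _+_; _*_; _≡ᵇ_; s≤s; z≤n)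
import Data.Nat.Properties as ℕ
open import Data.Nat.GeneralisedArithmetic using (fold; fold-+)
import Data.Nat.Tactic.RingSolver as ℕ-Solver
open import Data.Product using (_×_; _,_; proj₁; proj₂)
open import Data.Unit using (tt)
open import Level using (0ℓ)
open import Relation.Binary.PropositionalEquality
  using (_≡_; _≢_; _≗_; refl; sym; trans; cong; cong₂; cong-app; subst; subst₂; module ≡-Reasoning)
open import Tactic.MonoidSolver using (solve)

m+m≡m*2 : ∀ m → m + m ≡ m * 2
m+m≡m*2 m = trans (cong (m +_) (sym (ℕ.+-identityʳ m))) (ℕ.*-comm 2 m)

data Parity : ℕ → Set where
  even : ∀ k → Parity (k * 2)
  odd  : ∀ k → Parity (suc (k * 2))

parity : ∀ m → Parity m
parity zero          = even 0
parity (suc zero)    = odd 0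
parity (suc (suc m)) with parity m
... | even k = even (suc k)
... | odd  k = odd (suc k)

fold-suc : ∀ {a} {X : Set a} (x : X) f n → fold x f (suc n) ≡ fold (f x) f n
fold-suc x f n = trans (cong (fold x f) (ℕ.+-comm 1 n)) (fold-+ x f n)

-- (g₁, …, g_L) ↦ (g₁ ▷ g₂, …, g₁ ▷ g_L, g₁): the action of σ_{L-1}⋯σ₁ when ▷ is conjugation
hurwitz : ∀ {a} {X : Set a} → (X → X → X) → List X → List X
hurwitz _▷_ []       = []
hurwitz _▷_ (x ∷ ys) = map (x ▷_) ys ++ [ x ]

length-hurwitz : ∀ {a} {X : Set a} (_▷_ : X → X → X) xs →
                 length (hurwitz _▷_ xs) ≡ length xs
length-hurwitz _▷_ []       = refl
length-hurwitz _▷_ (x ∷ ys) =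
  trans (List.length-++ (map (x ▷_) ys))
        (trans (cong (_+ 1) (List.length-map (x ▷_) ys)) (ℕ.+-comm (length ys) 1))

length-fold-hurwitz : ∀ {a} {X : Set a} (_▷_ : X → X → X) xs k →
                      length (fold xs (hurwitz _▷_) k) ≡ length xs
length-fold-hurwitz _▷_ xs zero    = refl
length-fold-hurwitz _▷_ xs (suc k) =
  trans (length-hurwitz _▷_ (fold xs (hurwitz _▷_) k)) (length-fold-hurwitz _▷_ xs k)

module Conjugation {c ℓ} (G : Group c ℓ) where

  open Group G renaming (refl to ≈-refl; sym to ≈-sym; trans to ≈-trans)
  open import Algebra.Properties.Group G using (⁻¹-anti-homo-∙; ε⁻¹≈ε; inverseʳ-unique)
  import Relation.Binary.Reasoning.Setoid as SetoidReasoning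
  open SetoidReasoning setoid

  conj : Carrier → Carrier → Carrier
  conj g h = g ∙ (h ∙ g ⁻¹)

  prod : List Carrier → Carrier
  prod = foldr _∙_ ε

  power : Carrier → ℕ → Carrier
  power g k = prod (replicate k g)

  conj-cong : ∀ {g g′ h h′} → g ≈ g′ → h ≈ h′ → conj g h ≈ conj g′ h′
  conj-cong g≈g′ h≈h′ = ∙-cong g≈g′ (∙-cong h≈h′ (⁻¹-cong g≈g′))

  conj-identityˡ : ∀ h → conj ε h ≈ h
  conj-identityˡ h = begin
    ε ∙ (h ∙ ε ⁻¹) ≈⟨ ∙-congˡ (∙-congˡ ε⁻¹≈ε) ⟩
    ε ∙ (h ∙ ε)    ≈⟨ solve monoid ⟩
    h              ∎

  conj-identityʳ : ∀ g → conj g ε ≈ ε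
  conj-identityʳ g = begin
    g ∙ (ε ∙ g ⁻¹) ≈⟨ solve monoid ⟩
    g ∙ g ⁻¹       ≈⟨ inverseʳ g ⟩
    ε              ∎

  conj-self : ∀ g → conj g g ≈ g
  conj-self g = ≈-trans (∙-congˡ (inverseʳ g)) (identityʳ g)

  conj-∙ : ∀ g h k → conj (g ∙ h) k ≈ conj g (conj h k)
  conj-∙ g h k = begin
    (g ∙ h) ∙ (k ∙ (g ∙ h) ⁻¹)    ≈⟨ ∙-congˡ (∙-congˡ (⁻¹-anti-homo-∙ g h)) ⟩
    (g ∙ h) ∙ (k ∙ (h ⁻¹ ∙ g ⁻¹)) ≈⟨ solve monoid ⟩
    g ∙ ((h ∙ (k ∙ h ⁻¹)) ∙ g ⁻¹) ∎

  conj-homo-∙ : ∀ g h k → conj g (h ∙ k) ≈ conj g h ∙ conj g k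
  conj-homo-∙ g h k = begin
    g ∙ ((h ∙ k) ∙ g ⁻¹)                  ≈⟨ solve monoid ⟩
    g ∙ (h ∙ (ε ∙ (k ∙ g ⁻¹)))            ≈⟨ ∙-congˡ (∙-congˡ (∙-congʳ (inverseˡ g))) ⟨
    g ∙ (h ∙ ((g ⁻¹ ∙ g) ∙ (k ∙ g ⁻¹)))   ≈⟨ solve monoid ⟩
    (g ∙ (h ∙ g ⁻¹)) ∙ (g ∙ (k ∙ g ⁻¹))   ∎

  conj-cancelʳ : ∀ g h → conj g h ∙ g ≈ g ∙ h
  conj-cancelʳ g h = begin
    (g ∙ (h ∙ g ⁻¹)) ∙ g  ≈⟨ solve monoid ⟩
    g ∙ (h ∙ (g ⁻¹ ∙ g))  ≈⟨ ∙-congˡ (∙-congˡ (inverseˡ g)) ⟩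
    g ∙ (h ∙ ε)           ≈⟨ solve monoid ⟩
    g ∙ h                 ∎

  conj-conj : ∀ g h k → conj (conj g h) (conj g k) ≈ conj g (conj h k)
  conj-conj g h k = begin
    conj (conj g h) (conj g k) ≈⟨ conj-∙ (conj g h) g k ⟨
    conj (conj g h ∙ g) k      ≈⟨ conj-cong (conj-cancelʳ g h) ≈-refl ⟩
    conj (g ∙ h) k             ≈⟨ conj-∙ g h k ⟩
    conj g (conj h k)          ∎

  prod-map-conj : ∀ g xs → prod (map (conj g) xs) ≈ conj g (prod xs)
  prod-map-conj g []       = ≈-sym (conj-identityʳ g)
  prod-map-conj g (x ∷ xs) = begin
    conj g x ∙ prod (map (conj g) xs) ≈⟨ ∙-congˡ (prod-map-conj g xs) ⟩
    conj g x ∙ conj g (prod xs)       ≈⟨ conj-homo-∙ g x (prod xs) ⟨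
    conj g (x ∙ prod xs)              ∎

  power-comm : ∀ g k → power g k ∙ g ≈ g ∙ power g k
  power-comm g zero    = ≈-trans (identityˡ g) (≈-sym (identityʳ g))
  power-comm g (suc k) = ≈-trans (assoc g (power g k) g) (∙-congˡ (power-comm g k))

  power-+ : ∀ g m n → power g (m + n) ≈ power g m ∙ power g n
  power-+ g zero    n = ≈-sym (identityˡ (power g n))
  power-+ g (suc m) n = ≈-trans (∙-congˡ (power-+ g m n)) (≈-sym (assoc g (power g m) (power g n)))

  power-double : ∀ g k → power g (k * 2) ≈ power g k ∙ power g k
  power-double g k = begin
    power g (k * 2)           ≡⟨ cong (power g) (m+m≡m*2 k) ⟨
    power g (k + k)           ≈⟨ power-+ g k k ⟩
    power g k ∙ power g k     ∎

  power-cong : ∀ {g g′} k → g ≈ g′ → power g k ≈ power g′ k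
  power-cong zero    g≈g′ = ≈-refl
  power-cong (suc k) g≈g′ = ∙-cong g≈g′ (power-cong k g≈g′)

  power-swap : ∀ x y k → x ∙ power (y ∙ x) k ≈ power (x ∙ y) k ∙ x
  power-swap x y zero    = ≈-trans (identityʳ x) (≈-sym (identityˡ x))
  power-swap x y (suc k) = begin
    x ∙ ((y ∙ x) ∙ power (y ∙ x) k) ≈⟨ solve monoid ⟩
    (x ∙ y) ∙ (x ∙ power (y ∙ x) k) ≈⟨ ∙-congˡ (power-swap x y k) ⟩
    (x ∙ y) ∙ (power (x ∙ y) k ∙ x) ≈⟨ solve monoid ⟩
    ((x ∙ y) ∙ power (x ∙ y) k) ∙ x ∎

  x⁻¹≈x⇒x∙x≈ε : ∀ x → x ⁻¹ ≈ x → x ∙ x ≈ ε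
  x⁻¹≈x⇒x∙x≈ε x x⁻¹≈x = ≈-trans (∙-congˡ (≈-sym x⁻¹≈x)) (inverseʳ x)

  ⁻¹-anti-homo-∙-involutions : ∀ x y → x ⁻¹ ≈ x → y ⁻¹ ≈ y → (x ∙ y) ⁻¹ ≈ y ∙ x
  ⁻¹-anti-homo-∙-involutions x y x⁻¹≈x y⁻¹≈y = ≈-trans (⁻¹-anti-homo-∙ x y) (∙-cong y⁻¹≈y x⁻¹≈x)

  module Dihedral {a b} (a⁻¹≈a : a ⁻¹ ≈ a) (b⁻¹≈b : b ⁻¹ ≈ b) where

    power-⁻¹ : ∀ k → power (a ∙ b) k ⁻¹ ≈ power (b ∙ a) k
    power-⁻¹ zero    = ε⁻¹≈ε
    power-⁻¹ (suc k) = begin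
      ((a ∙ b) ∙ power (a ∙ b) k) ⁻¹      ≈⟨ ⁻¹-anti-homo-∙ (a ∙ b) (power (a ∙ b) k) ⟩
      power (a ∙ b) k ⁻¹ ∙ (a ∙ b) ⁻¹     ≈⟨ ∙-cong (power-⁻¹ k) (⁻¹-anti-homo-∙-involutions a b a⁻¹≈a b⁻¹≈b) ⟩
      power (b ∙ a) k ∙ (b ∙ a)           ≈⟨ power-comm (b ∙ a) k ⟩
      (b ∙ a) ∙ power (b ∙ a) k           ∎

    conj-power-a : ∀ k → conj (power (a ∙ b) k) a ≈ (power (a ∙ b) k ∙ power (a ∙ b) k) ∙ a
    conj-power-a k = begin
      Q ∙ (a ∙ Q ⁻¹)             ≈⟨ ∙-congˡ (∙-congˡ (power-⁻¹ k)) ⟩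
      Q ∙ (a ∙ power (b ∙ a) k)  ≈⟨ ∙-congˡ (power-swap a b k) ⟩
      Q ∙ (Q ∙ a)                ≈⟨ assoc Q Q a ⟨
      (Q ∙ Q) ∙ a                ∎
      where Q = power (a ∙ b) k

    conj-power-fixes : ∀ k → power (a ∙ b) (k * 2) ≈ ε →
                       conj (power (a ∙ b) k) a ≈ a × conj (power (a ∙ b) k) b ≈ b
    conj-power-fixes k ab²ᵏ≈ε = fixes-a , fixes-b
      where
      Q = power (a ∙ b) k
      Q²≈ε : Q ∙ Q ≈ ε
      Q²≈ε = ≈-trans (≈-sym (power-double (a ∙ b) k)) ab²ᵏ≈ε
      fixes-a : conj Q a ≈ a
      fixes-a = ≈-trans (conj-power-a k) (≈-trans (∙-congʳ Q²≈ε) (identityˡ a))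
      fixes-b : conj Q b ≈ b
      fixes-b = begin
        Q ∙ (b ∙ Q ⁻¹)      ≈⟨ ∙-congˡ (∙-congˡ (inverseʳ-unique Q Q Q²≈ε)) ⟨
        Q ∙ (b ∙ Q)         ≈⟨ ∙-congˡ (power-swap b a k) ⟩
        Q ∙ (power (b ∙ a) k ∙ b) ≈⟨ ∙-congˡ (∙-congʳ (power-⁻¹ k)) ⟨
        Q ∙ (Q ⁻¹ ∙ b)      ≈⟨ assoc Q (Q ⁻¹) b ⟨
        (Q ∙ Q ⁻¹) ∙ b      ≈⟨ ∙-congʳ (inverseʳ Q) ⟩
        ε ∙ b               ≈⟨ identityˡ b ⟩
        b                   ∎

    conj-power-swaps : ∀ k → power (a ∙ b) (suc (k * 2)) ≈ ε →
                       conj (power (a ∙ b) k) a ≈ b ×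
                       conj (conj (power (a ∙ b) k) a) (conj (power (a ∙ b) k) b) ≈ a
    conj-power-swaps k ab²ᵏ⁺¹≈ε = a↦b , ab↦a
      where
      Q = power (a ∙ b) k
      Q²≈ba : Q ∙ Q ≈ b ∙ a
      Q²≈ba = begin
        Q ∙ Q                   ≈⟨ power-double (a ∙ b) k ⟨
        power (a ∙ b) (k * 2)   ≈⟨ inverseʳ-unique (a ∙ b) _ ab²ᵏ⁺¹≈ε ⟩
        (a ∙ b) ⁻¹              ≈⟨ ⁻¹-anti-homo-∙-involutions a b a⁻¹≈a b⁻¹≈b ⟩
        b ∙ a                   ∎
      a↦b : conj Q a ≈ b
      a↦b = begin
        conj Q a        ≈⟨ conj-power-a k ⟩
        (Q ∙ Q) ∙ a     ≈⟨ ∙-congʳ Q²≈ba ⟩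
        (b ∙ a) ∙ a     ≈⟨ assoc b a a ⟩
        b ∙ (a ∙ a)     ≈⟨ ∙-congˡ (x⁻¹≈x⇒x∙x≈ε a a⁻¹≈a) ⟩
        b ∙ ε           ≈⟨ identityʳ b ⟩
        b               ∎
      ab↦a : conj (conj Q a) (conj Q b) ≈ a
      ab↦a = begin
        conj (conj Q a) (conj Q b)    ≈⟨ conj-cong a↦b (conj-cong ≈-refl (≈-sym a↦b)) ⟩
        conj b (conj Q (conj Q a))    ≈⟨ conj-cong ≈-refl (conj-∙ Q Q a) ⟨
        conj b (conj (Q ∙ Q) a)       ≈⟨ conj-cong ≈-refl (conj-cong Q²≈ba ≈-refl) ⟩
        conj b (conj (b ∙ a) a)       ≈⟨ conj-cong ≈-refl (conj-∙ b a a) ⟩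
        conj b (conj b (conj a a))    ≈⟨ conj-cong ≈-refl (conj-cong ≈-refl (conj-self a)) ⟩
        conj b (conj b a)             ≈⟨ conj-∙ b b a ⟨
        conj (b ∙ b) a                ≈⟨ conj-cong (x⁻¹≈x⇒x∙x≈ε b b⁻¹≈b) ≈-refl ⟩
        conj ε a                      ≈⟨ conj-identityˡ a ⟩
        a                             ∎

module HurwitzAction {c ℓ} (G : Group c ℓ) where

  open Group G renaming (refl to ≈-refl; sym to ≈-sym; trans to ≈-trans)
  open Conjugation G
  open import Data.List.Relation.Binary.Equality.Setoid setoid
    using (_≋_; []; _∷_; ≋-refl; ≋-sym; ≋-trans; ≋-reflexive; ++⁺; ++⁺ˡ; ≋-setoid)
  open import Relation.Binary.Reasoning.Setoid ≋-setoid

  map-conj-cong : ∀ {g g′ xs ys} → g ≈ g′ → xs ≋ ys → map (conj g) xs ≋ map (conj g′) ys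
  map-conj-cong g≈g′ []             = []
  map-conj-cong g≈g′ (x≈y ∷ xs≋ys) = conj-cong g≈g′ x≈y ∷ map-conj-cong g≈g′ xs≋ys

  map-conj-identity : ∀ xs → map (conj ε) xs ≋ xs
  map-conj-identity []       = []
  map-conj-identity (x ∷ xs) = conj-identityˡ x ∷ map-conj-identity xs

  map-conj-conj : ∀ g h xs → map (conj (conj g h)) (map (conj g) xs) ≋ map (conj (g ∙ h)) xs
  map-conj-conj g h []       = []
  map-conj-conj g h (x ∷ xs) =
    ≈-trans (conj-conj g h x) (≈-sym (conj-∙ g h x)) ∷ map-conj-conj g h xs

  δ : List Carrier → List Carrier
  δ = hurwitz conj

  hurwitz-cong : ∀ {xs ys} → xs ≋ ys → δ xs ≋ δ ys
  hurwitz-cong []            = []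
  hurwitz-cong (x≈y ∷ xs≋ys) = ++⁺ (map-conj-cong x≈y xs≋ys) (x≈y ∷ [])

  fold-hurwitz-cong : ∀ k {xs ys} → xs ≋ ys → fold xs δ k ≋ fold ys δ k
  fold-hurwitz-cong zero    xs≋ys = xs≋ys
  fold-hurwitz-cong (suc k) xs≋ys = hurwitz-cong (fold-hurwitz-cong k xs≋ys)

  hurwitz-rotate : ∀ k xs ys → length xs ≡ k →
                   fold (xs ++ ys) δ k ≋ map (conj (prod xs)) (ys ++ xs)
  hurwitz-rotate zero    []       ys _ = ≋-sym (≋-trans (map-conj-identity (ys ++ []))
                                                       (≋-reflexive (List.++-identityʳ ys)))
  hurwitz-rotate (suc k) (x ∷ xs) ys |xs|≡k = begin
    fold (x ∷ xs ++ ys) δ (suc k)      ≡⟨ fold-suc (x ∷ xs ++ ys) δ k ⟩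
    fold (δ (x ∷ xs ++ ys)) δ k         ≡⟨ cong (λ zs → fold zs δ k) δ-split ⟩
    fold (xs′ ++ ys′) δ k               ≈⟨ hurwitz-rotate k xs′ ys′ |xs′|≡k ⟩
    map (conj (prod xs′)) (ys′ ++ xs′)  ≈⟨ map-conj-cong (prod-map-conj x xs) rotated ⟩
    map (conj (conj x (prod xs))) (map (conj x) (ys ++ x ∷ xs))
      ≈⟨ map-conj-conj x (prod xs) (ys ++ x ∷ xs) ⟩
    map (conj (x ∙ prod xs)) (ys ++ x ∷ xs) ∎
    where
    xs′ = map (conj x) xs
    ys′ = map (conj x) ys ++ [ x ]
    |xs′|≡k : length xs′ ≡ k
    |xs′|≡k = trans (List.length-map (conj x) xs) (ℕ.suc-injective |xs|≡k)
    δ-split : δ (x ∷ xs ++ ys) ≡ xs′ ++ ys′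
    δ-split = trans (cong (_++ [ x ]) (List.map-++ (conj x) xs ys))
                (List.++-assoc xs′ (map (conj x) ys) [ x ])
    rotated : ys′ ++ xs′ ≋ map (conj x) (ys ++ x ∷ xs)
    rotated = ≋-trans (≋-reflexive (List.++-assoc (map (conj x) ys) [ x ] xs′))
              (≋-trans (++⁺ˡ (map (conj x) ys) (≈-sym (conj-self x) ∷ ≋-refl))
                       (≋-reflexive (sym (List.map-++ (conj x) ys (x ∷ xs)))))

  hurwitz-full-turn : ∀ k xs → length xs ≡ k → fold xs δ k ≋ map (conj (prod xs)) xs
  hurwitz-full-turn k xs |xs|≡k = begin
    fold xs δ k                    ≡⟨ cong (λ zs → fold zs δ k) (List.++-identityʳ xs) ⟨
    fold (xs ++ []) δ k            ≈⟨ hurwitz-rotate k xs [] |xs|≡k ⟩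
    map (conj (prod xs)) xs        ∎

  hurwitz-power : ∀ xs k → fold xs δ (k * length xs) ≋ map (conj (power (prod xs) k)) xs
  hurwitz-power xs zero    = ≋-sym (map-conj-identity xs)
  hurwitz-power xs (suc k) = begin
    fold xs δ (length xs + k * length xs) ≡⟨ fold-+ xs δ (length xs) ⟩
    fold (fold xs δ (k * length xs)) δ (length xs)
      ≈⟨ fold-hurwitz-cong (length xs) (hurwitz-power xs k) ⟩
    fold (map (conj Pᵏ) xs) δ (length xs)
      ≈⟨ hurwitz-full-turn (length xs) (map (conj Pᵏ) xs) (List.length-map (conj Pᵏ) xs) ⟩
    map (conj (prod (map (conj Pᵏ) xs))) (map (conj Pᵏ) xs)
      ≈⟨ map-conj-cong (prod-map-conj Pᵏ xs) ≋-refl ⟩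
    map (conj (conj Pᵏ P)) (map (conj Pᵏ) xs) ≈⟨ map-conj-conj Pᵏ P xs ⟩
    map (conj (Pᵏ ∙ P)) xs                    ≈⟨ map-conj-cong (power-comm P k) ≋-refl ⟩
    map (conj (P ∙ Pᵏ)) xs                    ∎
    where
    P  = prod xs
    Pᵏ = power P k

  hurwitz-power-stable : ∀ xs k → power (prod xs) k ≈ ε → fold xs δ (k * length xs) ≋ xs
  hurwitz-power-stable xs k Pᵏ≈ε =
    ≋-trans (hurwitz-power xs k) (≋-trans (map-conj-cong Pᵏ≈ε ≋-refl) (map-conj-identity xs))

  hurwitz-pair-power : ∀ a b k →
    fold (a ∷ b ∷ []) δ (k * 2) ≋ conj (power (a ∙ b) k) a ∷ conj (power (a ∙ b) k) b ∷ []
  hurwitz-pair-power a b k = ≋-trans (hurwitz-power (a ∷ b ∷ []) k)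
    (map-conj-cong (power-cong k (∙-congˡ (identityʳ b))) ≋-refl)

  dihedral-hurwitz-stable : ∀ {a b} → a ⁻¹ ≈ a → b ⁻¹ ≈ b →
                            ∀ m → power (a ∙ b) m ≈ ε → fold (a ∷ b ∷ []) δ m ≋ a ∷ b ∷ []
  dihedral-hurwitz-stable {a} {b} a⁻¹≈a b⁻¹≈b m abᵐ≈ε with parity m
  ... | even k = ≋-trans (hurwitz-pair-power a b k) (proj₁ fixes ∷ proj₂ fixes ∷ [])
    where fixes = Dihedral.conj-power-fixes a⁻¹≈a b⁻¹≈b k abᵐ≈ε
  ... | odd k  = ≋-trans (hurwitz-cong (hurwitz-pair-power a b k)) (proj₂ swaps ∷ proj₁ swaps ∷ [])
    where swaps = Dihedral.conj-power-swaps a⁻¹≈a b⁻¹≈b k abᵐ≈ε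

sumFin-cong : ∀ {m} {f g : Fin m → ℤ} → f ≗ g → sumFin f ≡ sumFin g
sumFin-cong {zero}  f≗g = refl
sumFin-cong {suc m} f≗g = cong₂ _+ℤ_ (f≗g fzero) (sumFin-cong (λ q → f≗g (fsuc q)))

sumFin-update : ∀ {m} (f g : Fin m → ℤ) (p : Fin m) (c : ℤ) → g p ≡ f p -ℤ c →
                (∀ q → q ≢ p → g q ≡ f q) → sumFin g ≡ sumFin f -ℤ c
sumFin-update f g fzero c gp≡fp-c g≡f =
  trans (cong₂ _+ℤ_ gp≡fp-c (sumFin-cong (λ q → g≡f (fsuc q) (λ ()))))
        (shuffle (f fzero) c (sumFin (λ q → f (fsuc q))))
  where
  shuffle : ∀ x c s → (x -ℤ c) +ℤ s ≡ (x +ℤ s) -ℤ c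
  shuffle = solve-∀
sumFin-update f g (fsuc p) c gp≡fp-c g≡f =
  trans (cong₂ _+ℤ_ (g≡f fzero (λ ()))
          (sumFin-update (λ q → f (fsuc q)) (λ q → g (fsuc q)) p c gp≡fp-c
            (λ q q≢p → g≡f (fsuc q) (λ eq → q≢p (Fin.suc-injective eq)))))
        (shuffle (f fzero) c (sumFin (λ q → f (fsuc q))))
  where
  shuffle : ∀ x c s → x +ℤ (s -ℤ c) ≡ (x +ℤ s) -ℤ c
  shuffle = solve-∀

module WeylGroup {n : ℕ} (A : Mat n) (diag : ∀ p → A p p ≡ ℤ.+ 2) where

  -- ⟨α_p^∨, v⟩ for v = Σ_q v_q α_q
  pairing : Vect n → Fin n → ℤ
  pairing v p = sumFin (λ q → A p q *ℤ v q)

  refl-s-cong : ∀ i {u v} → u ≗ v → refl-s A i u ≗ refl-s A i v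
  refl-s-cong i u≗v p =
    cong₂ (λ x y → if suc (toℕ p) ≡ᵇ i then x -ℤ y else x)
          (u≗v p) (sumFin-cong (λ q → cong (A p q *ℤ_) (u≗v q)))

  eval-cong : ∀ w {u v} → u ≗ v → eval A w u ≗ eval A w v
  eval-cong []      u≗v = u≗v
  eval-cong (i ∷ w) u≗v = refl-s-cong i (eval-cong w u≗v)

  refl-s-moves : ∀ i v p → (suc (toℕ p) ≡ᵇ i) ≡ true → refl-s A i v p ≡ v p -ℤ pairing v p
  refl-s-moves i v p eq = cong (λ b → if b then v p -ℤ pairing v p else v p) eq

  refl-s-fixes : ∀ i v p → (suc (toℕ p) ≡ᵇ i) ≡ false → refl-s A i v p ≡ v p
  refl-s-fixes i v p eq = cong (λ b → if b then v p -ℤ pairing v p else v p) eq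

  ≡ᵇ-unique : ∀ i {p} (q : Fin n) → (suc (toℕ p) ≡ᵇ i) ≡ true → q ≢ p → (suc (toℕ q) ≡ᵇ i) ≡ false
  ≡ᵇ-unique i {p} q p↦i q≢p with suc (toℕ q) ≡ᵇ i in q↦i
  ... | false = refl
  ... | true  = ⊥-elim (q≢p (Fin.toℕ-injective (ℕ.suc-injective
                 (trans (index q q↦i) (sym (index p p↦i))))))
    where
    index : ∀ r → (suc (toℕ r) ≡ᵇ i) ≡ true → suc (toℕ r) ≡ i
    index r eq = ℕ.≡ᵇ⇒≡ (suc (toℕ r)) i (subst T (sym eq) tt)

  refl-s-involutive : ∀ i v → refl-s A i (refl-s A i v) ≗ v
  refl-s-involutive i v p with suc (toℕ p) ≡ᵇ i in p↦i
  ... | false = refl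
  ... | true  = begin
    (v p -ℤ s) -ℤ pairing w p          ≡⟨ cong ((v p -ℤ s) -ℤ_) pairing-w ⟩
    (v p -ℤ s) -ℤ (s -ℤ A p p *ℤ s)    ≡⟨ cong (λ a → (v p -ℤ s) -ℤ (s -ℤ a *ℤ s)) (diag p) ⟩
    (v p -ℤ s) -ℤ (s -ℤ ℤ.+ 2 *ℤ s)    ≡⟨ cancel (v p) s ⟩
    v p                                ∎
    where
    open ≡-Reasoning
    w = refl-s A i v
    s = pairing v p
    -- s_i moves only the p-th coordinate, by -s, so the pairing moves by -a_pp s
    pairing-w : pairing w p ≡ s -ℤ A p p *ℤ s
    pairing-w = sumFin-update (λ q → A p q *ℤ v q) (λ q → A p q *ℤ w q) p (A p p *ℤ s)
      (trans (cong (A p p *ℤ_) (refl-s-moves i v p p↦i)) (distrib (A p p) (v p) s))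
      (λ q q≢p → cong (A p q *ℤ_) (refl-s-fixes i v q (≡ᵇ-unique i q p↦i q≢p)))
      where
      distrib : ∀ a x y → a *ℤ (x -ℤ y) ≡ a *ℤ x -ℤ a *ℤ y
      distrib = solve-∀
    cancel : ∀ x s → (x -ℤ s) -ℤ (s -ℤ ℤ.+ 2 *ℤ s) ≡ x
    cancel = solve-∀

  eval-++ : ∀ w w′ v → eval A (w ++ w′) v ≡ eval A w (eval A w′ v)
  eval-++ w w′ v = List.foldr-++ (refl-s A) v w w′

  eval-inverseˡ : ∀ w v → eval A (inv w) (eval A w v) ≗ v
  eval-inverseˡ []      v p = refl
  eval-inverseˡ (i ∷ w) v p = begin
    eval A (reverse (i ∷ w)) u p         ≡⟨ cong (λ x → eval A x u p) (List.unfold-reverse i w) ⟩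
    eval A (reverse w ++ i ∷ []) u p     ≡⟨ cong-app (eval-++ (reverse w) (i ∷ []) u) p ⟩
    eval A (reverse w) (refl-s A i u) p  ≡⟨ eval-cong (reverse w) (refl-s-involutive i (eval A w v)) p ⟩
    eval A (reverse w) (eval A w v) p    ≡⟨ eval-inverseˡ w v p ⟩
    v p                                  ∎
    where
    open ≡-Reasoning
    u = refl-s A i (eval A w v)

  eval-inverseʳ : ∀ w v → eval A w (eval A (inv w) v) ≗ v
  eval-inverseʳ w v = subst (λ x → eval A x (eval A (inv w) v) ≗ v)
                            (List.reverse-involutive w) (eval-inverseˡ (inv w) v)

  ++-cong : ∀ {w w′ u u′} → w ≈[ A ] w′ → u ≈[ A ] u′ → (w ++ u) ≈[ A ] (w′ ++ u′)
  ++-cong {w} {w′} {u} {u′} w≈w′ u≈u′ v p = begin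
    eval A (w ++ u) v p          ≡⟨ cong-app (eval-++ w u v) p ⟩
    eval A w (eval A u v) p      ≡⟨ eval-cong w (u≈u′ v) p ⟩
    eval A w (eval A u′ v) p     ≡⟨ w≈w′ (eval A u′ v) p ⟩
    eval A w′ (eval A u′ v) p    ≡⟨ cong-app (eval-++ w′ u′ v) p ⟨
    eval A (w′ ++ u′) v p        ∎
    where open ≡-Reasoning

  inv-cong : ∀ {w w′} → w ≈[ A ] w′ → inv w ≈[ A ] inv w′
  inv-cong {w} {w′} w≈w′ v p = begin
    eval A (inv w) v p                             ≡⟨ eval-cong (inv w) (eval-inverseʳ w′ v) p ⟨
    eval A (inv w) (eval A w′ (eval A (inv w′) v)) p ≡⟨ eval-cong (inv w) (w≈w′ _) p ⟨
    eval A (inv w) (eval A w (eval A (inv w′) v)) p  ≡⟨ eval-inverseˡ w _ p ⟩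
    eval A (inv w′) v p                            ∎
    where open ≡-Reasoning

  ≡⇒≈ : ∀ {w w′} → w ≡ w′ → w ≈[ A ] w′
  ≡⇒≈ refl v p = refl

  wordGroup : Group 0ℓ 0ℓ
  wordGroup = record
    { Carrier = Word
    ; _≈_     = λ w w′ → w ≈[ A ] w′
    ; _∙_     = _++_
    ; ε       = []
    ; _⁻¹     = inv
    ; isGroup = record
      { isMonoid = record
        { isSemigroup = record
          { isMagma = record
            { isEquivalence = record
              { refl  = λ v p → refl
              ; sym   = λ w≈w′ v p → sym (w≈w′ v p)
              ; trans = λ w≈w′ w′≈w″ v p → trans (w≈w′ v p) (w′≈w″ v p)
              }
            ; ∙-cong = λ {w} {w′} {u} {u′} → ++-cong {w} {w′} {u} {u′}
            }
          ; assoc = λ w w′ w″ → ≡⇒≈ (List.++-assoc w w′ w″)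
          }
        ; identity = (λ w v p → refl) , (λ w → ≡⇒≈ (List.++-identityʳ w))
        }
      ; inverse = (λ w v p → trans (cong-app (eval-++ (inv w) w v) p) (eval-inverseˡ w v p))
                , (λ w v p → trans (cong-app (eval-++ w (inv w) v) p) (eval-inverseʳ w v p))
      ; ⁻¹-cong = λ {w} {w′} → inv-cong {w} {w′}
      }
    }

upFrom : ℕ → ℕ → List ℕ
upFrom s zero    = []
upFrom s (suc k) = s ∷ upFrom (suc s) k

length-upFrom : ∀ s k → length (upFrom s k) ≡ k
length-upFrom s zero    = refl
length-upFrom s (suc k) = cong suc (length-upFrom (suc s) k)

upFrom-+ : ∀ s a b → upFrom s (a + b) ≡ upFrom s a ++ upFrom (s + a) b
upFrom-+ s zero    b = cong (λ t → upFrom t b) (sym (ℕ.+-identityʳ s))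
upFrom-+ s (suc a) b = cong (s ∷_) (trans (upFrom-+ (suc s) a b)
                                      (cong (λ t → upFrom (suc s) a ++ upFrom t b) (sym (ℕ.+-suc s a))))

upFrom-suc : ∀ s k → upFrom (suc s) k ≡ map suc (upFrom s k)
upFrom-suc s zero    = refl
upFrom-suc s (suc k) = cong (suc s ∷_) (upFrom-suc (suc s) k)

applyUpTo-upFrom : ∀ k (f : ℕ → ℕ) s → (∀ x → f x ≡ s + x) → applyUpTo f k ≡ upFrom s k
applyUpTo-upFrom zero    f s f≗s+ = refl
applyUpTo-upFrom (suc k) f s f≗s+ =
  cong₂ _∷_ (trans (f≗s+ 0) (ℕ.+-identityʳ s))
            (applyUpTo-upFrom k (λ x → f (suc x)) (suc s) (λ x → trans (f≗s+ (suc x)) (ℕ.+-suc s x)))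

range-upFrom : ∀ i j → range i j ≡ upFrom i (suc j ∸ i)
range-upFrom i j = applyUpTo-upFrom _ (i +_) i (λ _ → refl)

range≡upFrom : ∀ a m → range (suc a) (a + m) ≡ upFrom (suc a) m
range≡upFrom a m = trans (range-upFrom (suc a) (a + m)) (cong (upFrom (suc a)) (ℕ.m+n∸m≡n a m))

reflections : ℕ → ℕ → Tuple
reflections s k = map [_] (upFrom s k)

length-reflections : ∀ s k → length (reflections s k) ≡ k
length-reflections s k = trans (List.length-map [_] (upFrom s k)) (length-upFrom s k)

descending : ℕ → ℕ → BraidWord
descending s m = reverse (upFrom s m)

descending-suc : ∀ s m → descending (suc s) m ≡ map suc (descending s m)
descending-suc s m = trans (cong reverse (upFrom-suc s m)) (sym (List.reverse-map suc (upFrom s m)))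

wordConj : Word → Word → Word
wordConj x y = x ++ y ++ inv x

bact-++ : ∀ β γ t → bact (β ++ γ) t ≡ bact β (bact γ t)
bact-++ β γ t = List.foldr-++ σact t β γ

bact-bpow : ∀ β k t → bact (bpow β k) t ≡ fold t (bact β) k
bact-bpow β zero    t = refl
bact-bpow β (suc k) t = trans (bact-++ β (bpow β k) t) (cong (bact β) (bact-bpow β k t))

bact-shift : ∀ β c t → bact (map suc (map suc β)) (c ∷ t) ≡ c ∷ bact (map suc β) t
bact-shift []      c t = refl
bact-shift (k ∷ β) c t = cong (σact (suc (suc k))) (bact-shift β c t)

bact-descending-∷ : ∀ s m c t →
  bact (descending (suc (suc s)) m) (c ∷ t) ≡ c ∷ bact (descending (suc s) m) t
bact-descending-∷ s m c t = begin
  bact (descending (suc (suc s)) m) (c ∷ t)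
    ≡⟨ cong (λ β → bact β (c ∷ t)) (trans (descending-suc (suc s) m) (cong (map suc) (descending-suc s m))) ⟩
  bact (map suc (map suc (descending s m))) (c ∷ t)  ≡⟨ bact-shift (descending s m) c t ⟩
  c ∷ bact (map suc (descending s m)) t              ≡⟨ cong (λ β → c ∷ bact β t) (descending-suc s m) ⟨
  c ∷ bact (descending (suc s) m) t                  ∎
  where open ≡-Reasoning

bact-descending-prefix : ∀ pre m r →
  bact (descending (suc (length pre)) m) (pre ++ r) ≡ pre ++ bact (descending 1 m) r
bact-descending-prefix []        m r = refl
bact-descending-prefix (c ∷ pre) m r =
  trans (bact-descending-∷ (length pre) m c (pre ++ r))
        (cong (c ∷_) (bact-descending-prefix pre m r))

bact-descending-hurwitz : ∀ x ys post →
  bact (descending 1 (length ys)) (x ∷ ys ++ post) ≡ hurwitz wordConj (x ∷ ys) ++ post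
bact-descending-hurwitz x []       post = refl
bact-descending-hurwitz x (y ∷ ys) post = begin
  bact (reverse (1 ∷ upFrom 2 l)) (x ∷ y ∷ ys ++ post)
    ≡⟨ cong (λ β → bact β (x ∷ y ∷ ys ++ post)) (List.unfold-reverse 1 (upFrom 2 l)) ⟩
  bact (descending 2 l ++ 1 ∷ []) (x ∷ y ∷ ys ++ post)
    ≡⟨ bact-++ (descending 2 l) (1 ∷ []) (x ∷ y ∷ ys ++ post) ⟩
  bact (descending 2 l) (wordConj x y ∷ x ∷ ys ++ post)
    ≡⟨ bact-descending-∷ 0 l (wordConj x y) (x ∷ ys ++ post) ⟩
  wordConj x y ∷ bact (descending 1 l) (x ∷ ys ++ post)
    ≡⟨ cong (wordConj x y ∷_) (bact-descending-hurwitz x ys post) ⟩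
  wordConj x y ∷ hurwitz wordConj (x ∷ ys) ++ post ∎
  where
  open ≡-Reasoning
  l = length ys

bact-descending-block : ∀ pre mid post m → length mid ≡ suc m →
  bact (descending (suc (length pre)) m) (pre ++ mid ++ post) ≡ pre ++ hurwitz wordConj mid ++ post
bact-descending-block pre (x ∷ ys) post .(length ys) refl =
  trans (bact-descending-prefix pre (length ys) (x ∷ ys ++ post))
        (cong (pre ++_) (bact-descending-hurwitz x ys post))

bpow-descending-block : ∀ pre mid post {a m} K → length pre ≡ a → length mid ≡ suc m →
  bact (bpow (descending (suc a) m) K) (pre ++ mid ++ post)
    ≡ pre ++ fold mid (hurwitz wordConj) K ++ post
bpow-descending-block pre mid post {m = m} K refl |mid|≡1+m =
  trans (bact-bpow (descending (suc (length pre)) m) K (pre ++ mid ++ post)) (fold-block K)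
  where
  fold-block : ∀ K → fold (pre ++ mid ++ post) (bact (descending (suc (length pre)) m)) K
                   ≡ pre ++ fold mid (hurwitz wordConj) K ++ post
  fold-block zero    = refl
  fold-block (suc K) =
    trans (cong (bact (descending (suc (length pre)) m)) (fold-block K))
          (bact-descending-block pre (fold mid (hurwitz wordConj) K) post m
            (trans (length-fold-hurwitz wordConj mid K) |mid|≡1+m))

stdTuple-split : ∀ n a k e → n ≡ a + (k + e) →
                 stdTuple n ≡ reflections 1 a ++ reflections (suc a) k ++ reflections (suc a + k) e
stdTuple-split n a k e n≡a+k+e = begin
  map [_] (range 1 n)                ≡⟨ cong (map [_]) (range≡upFrom 0 n) ⟩
  reflections 1 n                    ≡⟨ cong (reflections 1) n≡a+k+e ⟩
  map [_] (upFrom 1 (a + (k + e)))   ≡⟨ cong (map [_]) (upFrom-+ 1 a (k + e)) ⟩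
  map [_] (upFrom 1 a ++ upFrom (suc a) (k + e))
    ≡⟨ cong (λ xs → map [_] (upFrom 1 a ++ xs)) (upFrom-+ (suc a) k e) ⟩
  map [_] (upFrom 1 a ++ upFrom (suc a) k ++ upFrom (suc a + k) e)
    ≡⟨ List.map-++ [_] (upFrom 1 a) _ ⟩
  reflections 1 a ++ map [_] (upFrom (suc a) k ++ upFrom (suc a + k) e)
    ≡⟨ cong (reflections 1 a ++_) (List.map-++ [_] (upFrom (suc a) k) _) ⟩
  reflections 1 a ++ reflections (suc a) k ++ reflections (suc a + k) e ∎
  where open ≡-Reasoning

module Stabiliser {n : ℕ} (A : Mat n) (diag : ∀ p → A p p ≡ ℤ.+ 2) where

  open WeylGroup A diag
  open HurwitzAction wordGroup using (δ; hurwitz-power-stable; dihedral-hurwitz-stable)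
  open import Data.List.Relation.Binary.Equality.Setoid (Group.setoid wordGroup)
    using (_≋_; ≋-setoid; ++⁺ˡ; ++⁺ʳ)
  open import Relation.Binary.Reasoning.Setoid ≋-setoid

  block-stable : ∀ a m e K → n ≡ a + (suc m + e) →
                 fold (reflections (suc a) (suc m)) δ K ≋ reflections (suc a) (suc m) →
                 InStab A (bpow (descending (suc a) m) K)
  block-stable a m e K n≡a+1+m+e stable = begin
    bact β (stdTuple n)                 ≡⟨ cong (bact β) split ⟩
    bact β (pre ++ mid ++ post)
      ≡⟨ bpow-descending-block pre mid post K
           (length-reflections 1 a) (length-reflections (suc a) (suc m)) ⟩
    pre ++ fold mid δ K ++ post         ≈⟨ ++⁺ˡ pre (++⁺ʳ post stable) ⟩
    pre ++ mid ++ post                  ≡⟨ split ⟨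
    stdTuple n                          ∎
    where
    β    = bpow (descending (suc a) m) K
    pre  = reflections 1 a
    mid  = reflections (suc a) (suc m)
    post = reflections (suc a + suc m) e
    split = stdTuple-split n a (suc m) e n≡a+1+m+e

  descending-power-stable : ∀ a m e h → n ≡ a + (suc m + e) →
    pow (upFrom (suc a) (suc m)) h ≈[ A ] [] → InStab A (bpow (descending (suc a) m) (h * suc m))
  descending-power-stable a m e h n≡a+1+m+e cʰ≈1 = block-stable a m e (h * suc m) n≡a+1+m+e
    (subst (λ L → fold mid δ (h * L) ≋ mid) (length-reflections (suc a) (suc m))
      (hurwitz-power-stable mid h
        (subst (λ w → pow w h ≈[ A ] []) (sym (List.concat-map-[ upFrom (suc a) (suc m) ])) cʰ≈1)))
    where mid = reflections (suc a) (suc m)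

  σ-power-stable : ∀ a e m → n ≡ a + (2 + e) →
    pow (suc a ∷ suc (suc a) ∷ []) m ≈[ A ] [] → InStab A (bpow (suc a ∷ []) m)
  σ-power-stable a e m n≡a+2+e abᵐ≈1 = block-stable a 1 e m n≡a+2+e
    (dihedral-hurwitz-stable {suc a ∷ []} {suc (suc a) ∷ []} (λ v p → refl) (λ v p → refl) m abᵐ≈1)

  σ-stable : ∀ i m → 1 ≤ i → i < n →
             pow (i ∷ suc i ∷ []) m ≈[ A ] [] → InStab A (bpow (i ∷ []) m)
  σ-stable (suc a) m (s≤s z≤n) i<n with ℕ.m≤n⇒∃[o]m+o≡n i<n
  ... | e , 2+a+e≡n = σ-power-stable a e m (trans (sym 2+a+e≡n) (reassoc a e))
    where
    reassoc : ∀ a e → suc (suc a) + e ≡ a + (2 + e)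
    reassoc = ℕ-Solver.solve-∀

  descB-stable : ∀ i j h → 1 ≤ i → i ≤ j → j ≤ n → pow (coxElt i j) h ≈[ A ] [] →
                 InStab A (bpow (descB i j) ((j ∸ i + 1) * h))
  descB-stable (suc a) j h (s≤s z≤n) i≤j j≤n cʰ≈1 with ℕ.m≤n⇒∃[o]m+o≡n i≤j | ℕ.m≤n⇒∃[o]m+o≡n j≤n
  ... | m , refl | e , j+e≡n =
    subst₂ (λ β K → InStab A (bpow β K)) (cong reverse (sym (range≡upFrom a m))) exponent
      (descending-power-stable a m e h n≡a+1+m+e
        (subst (λ w → pow w h ≈[ A ] []) coxElt≡ cʰ≈1))
    where
    n≡a+1+m+e : n ≡ a + (suc m + e)
    n≡a+1+m+e = trans (sym j+e≡n) (reassoc a m e)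
      where
      reassoc : ∀ a m e → suc a + m + e ≡ a + (suc m + e)
      reassoc = ℕ-Solver.solve-∀
    coxElt≡ : coxElt (suc a) (suc a + m) ≡ upFrom (suc a) (suc m)
    coxElt≡ = trans (cong (range (suc a)) (sym (ℕ.+-suc a m))) (range≡upFrom a (suc m))
    exponent : h * suc m ≡ (suc a + m ∸ suc a + 1) * h
    exponent = trans (ℕ.*-comm h (suc m))
                     (cong (_* h) (trans (ℕ.+-comm 1 m) (cong (_+ 1) (sym (ℕ.m+n∸m≡n a m)))))

coxeter-stable : ∀ {n} (A : Mat n) → (∀ p → A p p ≡ ℤ.+ 2) →
                 ∀ h → pow (coxElt 1 n) h ≈[ A ] [] → InStab A (bpow (descB 1 n) (n * h))
coxeter-stable {zero}  A diag h _    = Pointwise.[]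
coxeter-stable {suc m} A diag h cʰ≈1 =
  subst (λ k → InStab A (bpow (descB 1 (suc m)) (k * h))) (ℕ.+-comm m 1)
        (Stabiliser.descB-stable A diag 1 (suc m) h ℕ.≤-refl (s≤s z≤n) ℕ.≤-refl cʰ≈1)

-- Finiteness, the minimality of the orders and the value of m are not needed:
-- only the relations c_ij^h = 1 and (s_i s_{i+1})^m = 1 enter.
lemma4p7 : (n : ℕ) (A : Mat n) → IsGCM A → FiniteWeyl A →
    (∀ i j h → 1 ≤ i → i < j → j ≤ n ∸ 1 → IsOrder A (coxElt i j) h →
      InStab A (bpow (descB i j) ((j ∸ i + 1) * h)))
    × (∀ h → IsOrder A (coxElt 1 n) h → InStab A (bpow (descB 1 n) (n * h)))
    × (∀ i m → 1 ≤ i → i < n → MVal (ent A i (suc i) *ℤ ent A (suc i) i) m →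
      pow (i ∷ suc i ∷ []) m ≈[ A ] [] → InStab A (bpow (i ∷ []) m))
lemma4p7 n A gcm _ =
    (λ i j h 1≤i i<j j≤n-1 (_ , cʰ≈1 , _) →
       descB-stable i j h 1≤i (ℕ.<⇒≤ i<j) (ℕ.≤-trans j≤n-1 (ℕ.m∸n≤m n 1)) cʰ≈1)
  , (λ h (_ , cʰ≈1 , _) → coxeter-stable A (IsGCM.diag gcm) h cʰ≈1)
  , (λ i m 1≤i i<n _ → σ-stable i m 1≤i i<n)
  where open Stabiliser A (IsGCM.diag gcm)
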